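{- The complexity class $\mathbf{P}$, viewed as a set of languages and hence as a subset of $2^\omega$, is $\boldsymbol{\Sigma}^0_2$-complete: $\mathbf{P}\in\boldsymbol{\Sigma}^0_2$ and $\mathbf{P}\notin\boldsymbol{\Pi}^0_2$.
   Context: Binary strings are identified with natural numbers via a fixed effective enumeration of $\{0,1\}^{<\omega}$, so that a language (a set of binary strings) is identified with an element of the Cantor space $2^\omega$ (product topology). $\boldsymbol{\Sigma}^0_2$ is the class of countable unions of closed subsets of $2^\omega$; $\boldsymbol{\Pi}^0_2$ the class of countable intersections of open sets. -}

module Defs where

open import Data.Nat using (ℕ; zero; suc; _+_; _*_; _^_; _≤_)
open import Data.Bool using (Bool; true; false)
open import Data.List using (List; []; _∷_; length)
open import Data.Fin using (Fin)
open import Data.Product using (Σ; _×_; _,_)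
open import Data.Sum using (_⊎_; inj₁; inj₂)
open import Data.Empty using (⊥)
open import Relation.Nullary using (¬_)
open import Relation.Binary.PropositionalEquality using (_≡_)
open import Function.Bundles using (_⇔_)

-- Binary strings and the fixed effective enumeration of {0,1}^{<ω}.
-- code is the (bijective) shortlex-style numbering: bijective base-2
-- numeration with the first symbol as least significant digit.

BinStr : Set
BinStr = List Bool

code : BinStr → ℕ
code []          = 0
code (false ∷ w) = suc (2 * code w)
code (true  ∷ w) = suc (suc (2 * code w))

-- Cantor space 2^ω; a point X is the language {w | X (code w) ≡ true}.

Cantor : Set
Cantor = ℕ → Bool

prefix : Cantor → ℕ → List Bool
prefix X zero    = []
prefix X (suc n) = X 0 ∷ prefix (λ i → X (suc i)) n

-- An open set is given by an arbitrary set S of finite strings: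
-- it is the union of the basic cylinders [s], s ∈ S.
OpenCode : Set₁
OpenCode = List Bool → Set

_∈Open_ : Cantor → OpenCode → Set
X ∈Open S = Σ ℕ λ n → S (prefix X n)

_∈Closed_ : Cantor → OpenCode → Set
X ∈Closed S = ¬ (X ∈Open S)

IsΣ⁰₂ : (Cantor → Set) → Set₁
IsΣ⁰₂ A = Σ (ℕ → OpenCode) λ C → ∀ X → A X ⇔ (Σ ℕ λ k → X ∈Closed C k)

IsΠ⁰₂ : (Cantor → Set) → Set₁
IsΠ⁰₂ A = Σ (ℕ → OpenCode) λ U → ∀ X → A X ⇔ (∀ k → X ∈Open U k)

data Sym : Set where
  s0 s1 blank : Sym

data Move : Set where
  L R : Move

record TM : Set where
  field
    nQ : ℕ                     -- states are Fin (suc nQ); start state is 0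
    δ  : Fin (suc nQ) → Sym →
         Bool ⊎ (Fin (suc nQ) × Sym × Move)
         -- inj₁ b : halt with output b (accept = true)
         -- inj₂ (q , a , m) : go to q, write a, move head m

-- Tape: cells left of the head (nearest first), scanned cell, cells right.
record Tape : Set where
  constructor tape
  field
    left  : List Sym
    cur   : Sym
    right : List Sym

write : Sym → Tape → Tape
write a (tape l _ r) = tape l a r

moveHead : Move → Tape → Tape
moveHead L (tape []      c r) = tape [] blank (c ∷ r)
moveHead L (tape (x ∷ l) c r) = tape l x (c ∷ r)
moveHead R (tape l c [])      = tape (c ∷ l) blank []
moveHead R (tape l c (x ∷ r)) = tape (c ∷ l) x r

Config : TM → Set
Config M = Bool ⊎ (Fin (suc (TM.nQ M)) × Tape)

step : (M : TM) → Config M → Config M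
step M (inj₁ b) = inj₁ b
step M (inj₂ (q , t)) with TM.δ M q (Tape.cur t)
... | inj₁ b             = inj₁ b
... | inj₂ (q′ , a , m)  = inj₂ (q′ , moveHead m (write a t))

run : (M : TM) → ℕ → Config M → Config M
run M zero    c = c
run M (suc n) c = run M n (step M c)

bitSym : Bool → Sym
bitSym false = s0
bitSym true  = s1

symList : BinStr → List Sym
symList []      = []
symList (b ∷ w) = bitSym b ∷ symList w

inputTape : BinStr → Tape
inputTape []      = tape [] blank []
inputTape (b ∷ w) = tape [] (bitSym b) (symList w)

initConfig : (M : TM) → BinStr → Config M
initConfig M w = inj₂ (Fin.zero , inputTape w)

DecidesInTime : TM → ℕ → Cantor → Set
DecidesInTime M c X =
  ∀ (w : BinStr) → Σ ℕ λ t →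
    (t ≤ (length w + 2) ^ c) × (run M t (initConfig M w) ≡ inj₁ (X (code w)))

InP : Cantor → Set
InP X = Σ TM λ M → Σ ℕ λ c → DecidesInTime M c X

-- P is the union, over clocked machines (M , c), of the sets of languages M decides within
-- time (|w| + 2)^c.  Each of these sets is closed: whether M answers correctly on w within
-- the bound depends on the single bit X(code w), so a failure is visible on a finite prefix.
--
-- Suppose P were an intersection of open sets U k.  A table T of bits defines the language
-- "w ↦ T[|w|]" (false beyond T), which is in P, hence lies in U k by virtue of a finite prefix.
-- Build tables in stages: at stage k pad the table with false so that it covers that prefix,
-- then append one bit at a fresh length that the k-th clocked machine gets wrong.  The limit
-- language lies in every U k, yet no clocked machine decides it.

module Submission where

open import Defs
open import Data.Product using (_×_)
open import Relation.Nullary using (¬_)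

open import Data.Bool using (Bool; true; false; not)
import Data.Bool as Bool
open import Data.Bool.Properties using (not-¬)
open import Data.Empty using (⊥-elim)
open import Data.Fin using (Fin; zero; suc; toℕ)
open import Data.List using (List; []; _∷_; [_]; _++_; length; replicate)
open import Data.List.Properties using (++-assoc; ++-identityʳ; length-++-≤ˡ; length-++-≤ʳ; length-++-sucʳ; length-replicate)
open import Data.Nat using (ℕ; zero; suc; _+_; _*_; _^_; _≤_; _<_; _≤′_; ≤′-refl; ≤′-step; z≤n; s≤s; ⌊_/2⌋)
open import Data.Nat.Properties
open import Data.Product using (Σ; ∃-syntax; _,_; proj₁; proj₂)
open import Data.Sum using (_⊎_; inj₁; inj₂)
open import Data.Vec using (Vec; []; _∷_; lookup; tabulate)
open import Data.Vec.Properties using (lookup∘tabulate)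
open import Function.Base using (id; _∘_)
open import Function.Bundles using (_⇔_; mk⇔; Equivalence)
open import Function.Definitions using (StrictlySurjective)
import Function.Properties.Equivalence as ⇔
open import Relation.Nullary using (Dec; yes; no)
open import Relation.Binary.PropositionalEquality using (_≡_; refl; sym; trans; cong; cong₂; subst; module ≡-Reasoning)

-- Pairing and enumerations

next : ℕ × ℕ → ℕ × ℕ
next (zero  , b) = suc b , 0
next (suc a , b) = a , suc b

unpair : ℕ → ℕ × ℕ
unpair zero    = 0 , 0
unpair (suc n) = next (unpair n)

unpair-walk : ∀ k {n a b} → unpair n ≡ (k + a , b) → unpair (k + n) ≡ (a , k + b)
unpair-walk zero    eq = eq
unpair-walk (suc k) {n} {a} {b} eq = begin
  unpair (suc k + n) ≡⟨ cong unpair (sym (+-suc k n)) ⟩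
  unpair (k + suc n) ≡⟨ unpair-walk k (cong next eq) ⟩
  (a , k + suc b)    ≡⟨ cong (a ,_) (+-suc k b) ⟩
  (a , suc k + b)    ∎
  where open ≡-Reasoning

diagonalStart : ℕ → ℕ
diagonalStart zero    = 0
diagonalStart (suc d) = suc (d + diagonalStart d)

unpair-diagonalStart : ∀ d → unpair (diagonalStart d) ≡ (d , 0)
unpair-diagonalStart zero    = refl
unpair-diagonalStart (suc d) =
  trans (cong next (unpair-walk d (trans (unpair-diagonalStart d) d,0≡d+0,0)))
        (cong (λ e → suc e , 0) (+-identityʳ d))
  where
  d,0≡d+0,0 : (d , 0) ≡ (d + 0 , 0)
  d,0≡d+0,0 = cong (_, 0) (sym (+-identityʳ d))

pair : ℕ → ℕ → ℕ
pair a b = b + diagonalStart (b + a)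

unpair-pair : ∀ a b → unpair (pair a b) ≡ (a , b)
unpair-pair a b =
  trans (unpair-walk b (unpair-diagonalStart (b + a))) (cong (a ,_) (+-identityʳ b))

Enumerates : {A : Set} → (ℕ → A) → Set
Enumerates = StrictlySurjective _≡_

enumΣ : {A : Set} {B : A → Set} → (ℕ → A) → (∀ a → ℕ → B a) → ℕ → Σ A B
enumΣ e f n = e (proj₁ (unpair n)) , f (e (proj₁ (unpair n))) (proj₂ (unpair n))

enumΣ-surjective : {A : Set} {B : A → Set} {e : ℕ → A} {f : ∀ a → ℕ → B a} →
                   Enumerates e → (∀ a → Enumerates (f a)) → Enumerates (enumΣ e f)
enumΣ-surjective {e = e} {f} e-surj f-surj (a , b) with e-surj a
... | i , refl with f-surj (e i) b
... | j , refl = pair i j , cong (λ p → e (proj₁ p) , f (e (proj₁ p)) (proj₂ p)) (unpair-pair i j)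

byTag : {A B : Set} → (ℕ → A) → (ℕ → B) → ℕ × ℕ → A ⊎ B
byTag e f (zero  , i) = inj₁ (e i)
byTag e f (suc _ , j) = inj₂ (f j)

enum⊎ : {A B : Set} → (ℕ → A) → (ℕ → B) → ℕ → A ⊎ B
enum⊎ e f = byTag e f ∘ unpair

enum⊎-surjective : {A B : Set} {e : ℕ → A} {f : ℕ → B} →
                   Enumerates e → Enumerates f → Enumerates (enum⊎ e f)
enum⊎-surjective {e = e} {f} e-surj f-surj (inj₁ a) with e-surj a
... | i , refl = pair 0 i , cong (byTag e f) (unpair-pair 0 i)
enum⊎-surjective {e = e} {f} e-surj f-surj (inj₂ b) with f-surj b
... | j , refl = pair 1 j , cong (byTag e f) (unpair-pair 1 j)

enumVec : {A : Set} → (ℕ → A) → ∀ n → ℕ → Vec A n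
enumVec e zero    _ = []
enumVec e (suc n) k = let (x , xs) = enumΣ e (λ _ → enumVec e n) k in x ∷ xs

enumVec-surjective : {A : Set} {e : ℕ → A} → Enumerates e → ∀ n → Enumerates (enumVec e n)
enumVec-surjective e-surj zero    []       = 0 , refl
enumVec-surjective e-surj (suc n) (x ∷ xs) with enumΣ-surjective e-surj (λ _ → enumVec-surjective e-surj n) (x , xs)
... | k , eq = k , cong (λ p → proj₁ p ∷ proj₂ p) eq

enumFin : ∀ n → ℕ → Fin (suc n)
enumFin n       zero    = zero
enumFin zero    (suc k) = zero
enumFin (suc n) (suc k) = suc (enumFin n k)

enumFin-surjective : ∀ n → Enumerates (enumFin n)
enumFin-surjective n       zero    = 0 , refl
enumFin-surjective (suc n) (suc i) =
  let k , eq = enumFin-surjective n i in suc k , cong suc eq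

enumBool : ℕ → Bool
enumBool zero    = false
enumBool (suc _) = true

enumBool-surjective : Enumerates enumBool
enumBool-surjective false = 0 , refl
enumBool-surjective true  = 1 , refl

enumSym : ℕ → Sym
enumSym 0 = s0
enumSym 1 = s1
enumSym _ = blank

enumSym-surjective : Enumerates enumSym
enumSym-surjective s0    = 0 , refl
enumSym-surjective s1    = 1 , refl
enumSym-surjective blank = 2 , refl

enumMove : ℕ → Move
enumMove zero    = L
enumMove (suc _) = R

enumMove-surjective : Enumerates enumMove
enumMove-surjective L = 0 , refl
enumMove-surjective R = 1 , refl

Action : ℕ → Set
Action m = Bool ⊎ (Fin (suc m) × Sym × Move)

symIndex : Sym → Fin 3
symIndex s0    = zero
symIndex s1    = suc zero
symIndex blank = suc (suc zero)

symAt : Fin 3 → Sym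
symAt zero             = s0
symAt (suc zero)       = s1
symAt (suc (suc zero)) = blank

symAt-symIndex : ∀ a → symAt (symIndex a) ≡ a
symAt-symIndex s0    = refl
symAt-symIndex s1    = refl
symAt-symIndex blank = refl

-- Transition functions can only be enumerated up to pointwise equality, tables exactly.
Table : ℕ → Set
Table m = Vec (Vec (Action m) 3) (suc m)

tableMachine : Σ ℕ Table → TM
tableMachine (m , table) = record { nQ = m ; δ = λ q a → lookup (lookup table q) (symIndex a) }

tableOf : TM → Σ ℕ Table
tableOf M = TM.nQ M , tabulate λ q → tabulate λ i → TM.δ M q (symAt i)

tableOf-δ : ∀ M q a → TM.δ (tableMachine (tableOf M)) q a ≡ TM.δ M q a
tableOf-δ M q a = begin
  lookup (lookup (tabulate λ q → tabulate λ i → TM.δ M q (symAt i)) q) (symIndex a)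
    ≡⟨ cong (λ row → lookup row (symIndex a)) (lookup∘tabulate (λ q → tabulate λ i → TM.δ M q (symAt i)) q) ⟩
  lookup (tabulate λ i → TM.δ M q (symAt i)) (symIndex a)
    ≡⟨ lookup∘tabulate (λ i → TM.δ M q (symAt i)) (symIndex a) ⟩
  TM.δ M q (symAt (symIndex a))
    ≡⟨ cong (TM.δ M q) (symAt-symIndex a) ⟩
  TM.δ M q a ∎
  where open ≡-Reasoning

module _ (M : TM) {δ′ : Fin (suc (TM.nQ M)) → Sym → Action (TM.nQ M)}
         (δ′≗δ : ∀ q a → δ′ q a ≡ TM.δ M q a) where

  private
    M′ : TM
    M′ = record M { δ = δ′ }

  step-δ-cong : ∀ C → step M′ C ≡ step M C
  step-δ-cong (inj₁ b) = refl
  step-δ-cong (inj₂ (q , t)) rewrite δ′≗δ q (Tape.cur t) with TM.δ M q (Tape.cur t)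
  ... | inj₁ _ = refl
  ... | inj₂ _ = refl

  run-δ-cong : ∀ n C → run M′ n C ≡ run M n C
  run-δ-cong zero    C = refl
  run-δ-cong (suc n) C rewrite step-δ-cong C = run-δ-cong n (step M C)

  decidesInTime-δ-cong : ∀ {c X} → DecidesInTime M c X → DecidesInTime M′ c X
  decidesInTime-δ-cong decides w =
    let t , t≤bound , halts = decides w in t , t≤bound , trans (run-δ-cong t _) halts

enumTable : ∀ m → ℕ → Table m
enumTable m = enumVec (enumVec (enum⊎ enumBool (enumΣ (enumFin m) λ _ → enumΣ enumSym λ _ → enumMove)) 3) (suc m)

enumTable-surjective : ∀ m → Enumerates (enumTable m)
enumTable-surjective m =
  enumVec-surjective (enumVec-surjective (enum⊎-surjective enumBool-surjective
    (enumΣ-surjective (enumFin-surjective m) λ _ → enumΣ-surjective enumSym-surjective λ _ → enumMove-surjective)) 3) (suc m)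

enumClocked : ℕ → Σ ℕ Table × ℕ
enumClocked = enumΣ (enumΣ id enumTable) λ _ → id

enumClocked-surjective : Enumerates enumClocked
enumClocked-surjective = enumΣ-surjective (enumΣ-surjective (_, refl) enumTable-surjective) λ _ → _, refl

machineAt : ℕ → TM
machineAt k = tableMachine (proj₁ (enumClocked k))

clockAt : ℕ → ℕ
clockAt k = proj₂ (enumClocked k)

DecidedBy : ℕ → Cantor → Set
DecidedBy k = DecidesInTime (machineAt k) (clockAt k)

InP⇔DecidedBy : ∀ X → InP X ⇔ (∃[ k ] DecidedBy k X)
InP⇔DecidedBy X = mk⇔ to (λ (k , decides) → machineAt k , clockAt k , decides)
  where
  to : InP X → ∃[ k ] DecidedBy k X
  to (M , c , decides) =
    let k , eq = enumClocked-surjective (tableOf M , c)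
    in k , subst (λ (C , c) → DecidesInTime (tableMachine C) c X) (sym eq)
                 (decidesInTime-δ-cong M (tableOf-δ M) {c} {X} decides)

-- Deciding within a time bound is a closed condition

timeBound : ℕ → BinStr → ℕ
timeBound c w = (length w + 2) ^ c

run-+ : ∀ M s t C → run M (s + t) C ≡ run M t (run M s C)
run-+ M zero    t C = refl
run-+ M (suc s) t C = run-+ M s t (step M C)

run-halted : ∀ M t b → run M t (inj₁ b) ≡ inj₁ b
run-halted M zero    b = refl
run-halted M (suc t) b = run-halted M t b

run-mono-halted : ∀ M {s t C b} → s ≤ t → run M s C ≡ inj₁ b → run M t C ≡ inj₁ b
run-mono-halted M {s} {t} {C} {b} s≤t halts = begin
  run M t C                 ≡⟨ cong (λ n → run M n C) (sym (proj₂ (m≤n⇒∃[o]m+o≡n s≤t))) ⟩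
  run M (s + o) C           ≡⟨ run-+ M s o C ⟩
  run M o (run M s C)       ≡⟨ cong (run M o) halts ⟩
  run M o (inj₁ b)          ≡⟨ run-halted M o b ⟩
  inj₁ b                    ∎
  where
  open ≡-Reasoning
  o = proj₁ (m≤n⇒∃[o]m+o≡n s≤t)

OutputsWithin : (M : TM) → ℕ → BinStr → Bool → Set
OutputsWithin M c w b = run M (timeBound c w) (initConfig M w) ≡ inj₁ b

outputsWithin? : ∀ M c w b → Dec (OutputsWithin M c w b)
outputsWithin? M c w b with run M (timeBound c w) (initConfig M w)
... | inj₂ _  = no λ ()
... | inj₁ b′ with b′ Bool.≟ b
...   | yes refl = yes refl
...   | no b′≢b  = no λ { refl → b′≢b refl }

decidesInTime⇔ : ∀ M c X → DecidesInTime M c X ⇔ (∀ w → OutputsWithin M c w (X (code w)))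
decidesInTime⇔ M c X = mk⇔ to (λ outputs w → timeBound c w , ≤-refl , outputs w)
  where
  to : DecidesInTime M c X → ∀ w → OutputsWithin M c w (X (code w))
  to decides w = let t , t≤bound , halts = decides w in run-mono-halted M t≤bound halts

output : {A : Set} → Bool ⊎ A → Bool
output (inj₁ b) = b
output (inj₂ _) = false

outputWithin : TM → ℕ → BinStr → Bool
outputWithin M c w = output (run M (timeBound c w) (initConfig M w))

bitAt : List Bool → ℕ → Bool
bitAt []       _       = false
bitAt (b ∷ bs) zero    = b
bitAt (b ∷ bs) (suc i) = bitAt bs i

length-prefix : ∀ X n → length (prefix X n) ≡ n
length-prefix X zero    = refl
length-prefix X (suc n) = cong suc (length-prefix (X ∘ suc) n)

bitAt-prefix : ∀ X {n i} → i < n → bitAt (prefix X n) i ≡ X i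
bitAt-prefix X {suc n} {zero}  _         = refl
bitAt-prefix X {suc n} {suc i} (s≤s i<n) = bitAt-prefix (X ∘ suc) i<n

prefix-cong : ∀ {X Y} n → (∀ {i} → i < n → X i ≡ Y i) → prefix X n ≡ prefix Y n
prefix-cong zero    X≗Y = refl
prefix-cong (suc n) X≗Y = cong₂ _∷_ (X≗Y (s≤s z≤n)) (prefix-cong n (X≗Y ∘ s≤s))

bitAt-++ˡ : ∀ T {S i} → i < length T → bitAt (T ++ S) i ≡ bitAt T i
bitAt-++ˡ (b ∷ T) {i = zero}  _         = refl
bitAt-++ˡ (b ∷ T) {i = suc i} (s≤s i<n) = bitAt-++ˡ T i<n

bitAt-++-length : ∀ T {b S} → bitAt (T ++ b ∷ S) (length T) ≡ b
bitAt-++-length []      = refl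
bitAt-++-length (_ ∷ T) = bitAt-++-length T

bitAt-replicate-false : ∀ n i → bitAt (replicate n false) i ≡ false
bitAt-replicate-false zero    i       = refl
bitAt-replicate-false (suc n) zero    = refl
bitAt-replicate-false (suc n) (suc i) = bitAt-replicate-false n i

bitAt-++-replicate-false : ∀ T n i → bitAt (T ++ replicate n false) i ≡ bitAt T i
bitAt-++-replicate-false []      n i       = bitAt-replicate-false n i
bitAt-++-replicate-false (b ∷ T) n zero    = refl
bitAt-++-replicate-false (b ∷ T) n (suc i) = bitAt-++-replicate-false T n i

Refutes : {I : Set} → (I → ℕ) → (I → Bool → Set) → OpenCode
Refutes {I} f P s = Σ I λ i → f i < length s × ¬ P i (bitAt s (f i))

pointwise⇔closed : ∀ {I : Set} (f : I → ℕ) (P : I → Bool → Set) → (∀ i b → Dec (P i b)) →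
                   ∀ X → (∀ i → P i (X (f i))) ⇔ X ∈Closed Refutes f P
pointwise⇔closed f P P? X = mk⇔ to from
  where
  to : (∀ i → P i (X (f i))) → X ∈Closed Refutes f P
  to holds (n , i , fi<n , ¬P) =
    ¬P (subst (P i) (sym (bitAt-prefix X (subst (f i <_) (length-prefix X n) fi<n))) (holds i))
  from : X ∈Closed Refutes f P → ∀ i → P i (X (f i))
  from closed i with P? i (X (f i))
  ... | yes p = p
  ... | no ¬p = ⊥-elim (closed (suc (f i) , i , fi<length , ¬p ∘ subst (P i) (bitAt-prefix X ≤-refl)))
    where
    fi<length : f i < length (prefix X (suc (f i)))
    fi<length = subst (f i <_) (sym (length-prefix X (suc (f i)))) ≤-refl

decidesInTime⇔closed : ∀ M c X → DecidesInTime M c X ⇔ X ∈Closed Refutes code (OutputsWithin M c)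
decidesInTime⇔closed M c X =
  ⇔.trans (decidesInTime⇔ M c X) (pointwise⇔closed code (OutputsWithin M c) (outputsWithin? M c) X)

InP-Σ⁰₂ : IsΣ⁰₂ InP
InP-Σ⁰₂ = (λ k → Refutes code (OutputsWithin (machineAt k) (clockAt k))) , λ X →
  ⇔.trans (InP⇔DecidedBy X)
          (mk⇔ (λ (k , decides) → k , Equivalence.to (closed k X) decides)
               (λ (k , inClosed) → k , Equivalence.from (closed k X) inClosed))
  where
  closed : ∀ k X → DecidedBy k X ⇔ X ∈Closed Refutes code (OutputsWithin (machineAt k) (clockAt k))
  closed k = decidesInTime⇔closed (machineAt k) (clockAt k)

-- Languages determined by word length

⌊2n/2⌋≡n : ∀ n → ⌊ 2 * n /2⌋ ≡ n
⌊2n/2⌋≡n n = trans (cong ⌊_/2⌋ (cong (n +_) (+-identityʳ n))) (sym (n≡⌊n+n/2⌋ n))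

⌊1+2n/2⌋≡n : ∀ n → ⌊ suc (2 * n) /2⌋ ≡ n
⌊1+2n/2⌋≡n zero    = refl
⌊1+2n/2⌋≡n (suc n) = cong suc (trans (cong ⌊_/2⌋ (+-suc n (n + 0))) (⌊1+2n/2⌋≡n n))

-- code (b ∷ w) is 1 + 2 · code w + (0 or 1), so n ↦ ⌊ (n ∸ 1) /2⌋ drops the first letter.
lengthWithin : ℕ → ℕ → ℕ
lengthWithin zero       _       = 0
lengthWithin (suc fuel) zero    = 0
lengthWithin (suc fuel) (suc n) = suc (lengthWithin fuel ⌊ n /2⌋)

lengthWithin-≤ : ∀ fuel n → lengthWithin fuel n ≤ fuel
lengthWithin-≤ zero       _       = z≤n
lengthWithin-≤ (suc fuel) zero    = z≤n
lengthWithin-≤ (suc fuel) (suc n) = s≤s (lengthWithin-≤ fuel ⌊ n /2⌋)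

lengthWithin-code : ∀ fuel w → length w ≤ fuel → lengthWithin fuel (code w) ≡ length w
lengthWithin-code zero       []          _        = refl
lengthWithin-code (suc fuel) []          _        = refl
lengthWithin-code (suc fuel) (false ∷ w) (s≤s ≤f) =
  cong suc (trans (cong (lengthWithin fuel) (⌊2n/2⌋≡n (code w))) (lengthWithin-code fuel w ≤f))
lengthWithin-code (suc fuel) (true ∷ w)  (s≤s ≤f) =
  cong suc (trans (cong (lengthWithin fuel) (⌊1+2n/2⌋≡n (code w))) (lengthWithin-code fuel w ≤f))

length≤code : ∀ w → length w ≤ code w
length≤code []          = z≤n
length≤code (false ∷ w) = s≤s (≤-trans (length≤code w) (m≤m+n (code w) _))
length≤code (true ∷ w)  = s≤s (≤-trans (length≤code w) (≤-trans (m≤m+n (code w) _) (n≤1+n _)))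

codeLength : ℕ → ℕ
codeLength n = lengthWithin n n

codeLength-≤ : ∀ n → codeLength n ≤ n
codeLength-≤ n = lengthWithin-≤ n n

codeLength-code : ∀ w → codeLength (code w) ≡ length w
codeLength-code w = lengthWithin-code (code w) w (length≤code w)

byLength : (ℕ → Bool) → Cantor
byLength f n = f (codeLength n)

sucSat : ∀ {n} → Fin (suc n) → Fin (suc n)
sucSat {zero}  zero    = zero
sucSat {suc n} zero    = suc zero
sucSat {suc n} (suc q) = suc (sucSat q)

bitAt-sucSat : ∀ T (q : Fin (suc (length T))) k → bitAt T (toℕ (sucSat q) + k) ≡ bitAt T (suc (toℕ q + k))
bitAt-sucSat []      zero    k = refl
bitAt-sucSat (b ∷ T) zero    k = refl
bitAt-sucSat (b ∷ T) (suc q) k = bitAt-sucSat T q k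

-- The state counts the bits read so far, saturating at length T, where bitAt is false anyway.
lengthMachine : List Bool → TM
lengthMachine T = record { nQ = length T ; δ = δ }
  where
  δ : Fin (suc (length T)) → Sym → Action (length T)
  δ q blank = inj₁ (bitAt T (toℕ q))
  δ q a     = inj₂ (sucSat q , a , R)

tapeAt : List Sym → BinStr → Tape
tapeAt l []      = tape l blank []
tapeAt l (b ∷ w) = tape l (bitSym b) (symList w)

inputTape≡tapeAt : ∀ w → inputTape w ≡ tapeAt [] w
inputTape≡tapeAt []      = refl
inputTape≡tapeAt (b ∷ w) = refl

moveRight-tapeAt : ∀ l a w → moveHead R (tape l a (symList w)) ≡ tapeAt (a ∷ l) w
moveRight-tapeAt l a []      = refl
moveRight-tapeAt l a (b ∷ w) = refl

lengthMachine-step : ∀ T q l b w →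
  step (lengthMachine T) (inj₂ (q , tapeAt l (b ∷ w))) ≡ inj₂ (sucSat q , tapeAt (bitSym b ∷ l) w)
lengthMachine-step T q l false w = cong (λ t → inj₂ (sucSat q , t)) (moveRight-tapeAt l s0 w)
lengthMachine-step T q l true  w = cong (λ t → inj₂ (sucSat q , t)) (moveRight-tapeAt l s1 w)

lengthMachine-run : ∀ T q l w →
  run (lengthMachine T) (suc (length w)) (inj₂ (q , tapeAt l w)) ≡ inj₁ (bitAt T (toℕ q + length w))
lengthMachine-run T q l []      = cong (inj₁ ∘ bitAt T) (sym (+-identityʳ (toℕ q)))
lengthMachine-run T q l (b ∷ w) = begin
  run M (suc (length w)) (step M (inj₂ (q , tapeAt l (b ∷ w))))
    ≡⟨ cong (run M (suc (length w))) (lengthMachine-step T q l b w) ⟩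
  run M (suc (length w)) (inj₂ (sucSat q , tapeAt (bitSym b ∷ l) w))
    ≡⟨ lengthMachine-run T (sucSat q) (bitSym b ∷ l) w ⟩
  inj₁ (bitAt T (toℕ (sucSat q) + length w))
    ≡⟨ cong inj₁ (bitAt-sucSat T q (length w)) ⟩
  inj₁ (bitAt T (suc (toℕ q + length w)))
    ≡⟨ cong (inj₁ ∘ bitAt T) (sym (+-suc (toℕ q) (length w))) ⟩
  inj₁ (bitAt T (toℕ q + suc (length w))) ∎
  where
  open ≡-Reasoning
  M = lengthMachine T

byLength-∈P : ∀ T → InP (byLength (bitAt T))
byLength-∈P T = lengthMachine T , 1 , λ w → suc (length w) , linear w , halts w
  where
  linear : ∀ w → suc (length w) ≤ (length w + 2) ^ 1
  linear w = subst (suc (length w) ≤_) (sym (^-identityʳ (length w + 2))) (m<m+n (length w) (s≤s z≤n))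
  halts : ∀ w → run (lengthMachine T) (suc (length w)) (initConfig (lengthMachine T) w)
                ≡ inj₁ (byLength (bitAt T) (code w))
  halts w rewrite inputTape≡tapeAt w | codeLength-code w = lengthMachine-run T zero [] w

-- Diagonalisation

module Diagonal (U : ℕ → OpenCode) (P⇔⋂U : ∀ X → InP X ⇔ (∀ k → X ∈Open U k)) where

  window : ℕ → List Bool → ℕ
  window k T = proj₁ (Equivalence.to (P⇔⋂U (byLength (bitAt T))) (byLength-∈P T) k)

  window-∈U : ∀ k T → U k (prefix (byLength (bitAt T)) (window k T))
  window-∈U k T = proj₂ (Equivalence.to (P⇔⋂U (byLength (bitAt T))) (byLength-∈P T) k)

  -- Padding with false does not change byLength (bitAt T) but puts its window inside the table,
  -- so all later stages keep the prefix that witnesses membership in U k.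
  padded : ℕ → List Bool → List Bool
  padded k T = T ++ replicate (window k T) false

  window≤length-padded : ∀ k T → window k T ≤ length (padded k T)
  window≤length-padded k T =
    subst (_≤ length (padded k T)) (length-replicate (window k T)) (length-++-≤ʳ (replicate (window k T) false) {T})

  witness : ℕ → List Bool → BinStr
  witness k T = replicate (length (padded k T)) false

  diagonalBit : ℕ → List Bool → Bool
  diagonalBit k T = not (outputWithin (machineAt k) (clockAt k) (witness k T))

  stages : ℕ → List Bool
  stages zero    = []
  stages (suc k) = padded k (stages k) ++ [ diagonalBit k (stages k) ]

  stages-extend : ∀ {a b} → a ≤′ b → ∃[ S ] stages b ≡ stages a ++ S
  stages-extend {a} ≤′-refl = [] , sym (++-identityʳ (stages a))
  stages-extend {a} (≤′-step {b} a≤b) =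
    let S , eq = stages-extend a≤b
        R = replicate (window b (stages b)) false
        d = [ diagonalBit b (stages b) ]
    in S ++ R ++ d , (begin
      (stages b ++ R) ++ d         ≡⟨ cong (λ T → (T ++ R) ++ d) eq ⟩
      ((stages a ++ S) ++ R) ++ d  ≡⟨ ++-assoc (stages a ++ S) R d ⟩
      (stages a ++ S) ++ R ++ d    ≡⟨ ++-assoc (stages a) S (R ++ d) ⟩
      stages a ++ S ++ R ++ d      ∎)
    where open ≡-Reasoning

  bitAt-stages : ∀ {a b i} → a ≤ b → i < length (stages a) → bitAt (stages b) i ≡ bitAt (stages a) i
  bitAt-stages {a} a≤b i<len =
    let S , eq = stages-extend (≤⇒≤′ a≤b)
    in trans (cong (λ T → bitAt T _) eq) (bitAt-++ˡ (stages a) i<len)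

  length-padded<length-stages : ∀ k → length (padded k (stages k)) < length (stages (suc k))
  length-padded<length-stages k = begin-strict
    length P                 <⟨ s≤s (length-++-≤ˡ P) ⟩
    suc (length (P ++ []))   ≡⟨ sym (length-++-sucʳ P (diagonalBit k (stages k)) []) ⟩
    length (stages (suc k))  ∎
    where
    open ≤-Reasoning
    P = padded k (stages k)

  k≤length-stages : ∀ k → k ≤ length (stages k)
  k≤length-stages zero    = z≤n
  k≤length-stages (suc k) =
    ≤-trans (s≤s (≤-trans (k≤length-stages k) (length-++-≤ˡ (stages k))))
            (length-padded<length-stages k)

  limit : ℕ → Bool
  limit j = bitAt (stages (suc j)) j

  limit-stages : ∀ {a j} → j < length (stages a) → limit j ≡ bitAt (stages a) j
  limit-stages {a} {j} j<len with ≤-total (suc j) a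
  ... | inj₁ j<a = sym (bitAt-stages j<a (k≤length-stages (suc j)))
  ... | inj₂ a≤j = bitAt-stages a≤j j<len

  D : Cantor
  D = byLength limit

  D-∈U : ∀ k → D ∈Open U k
  D-∈U k = n , subst (U k) (sym (prefix-cong n agree)) (window-∈U k T)
    where
    T = stages k
    n = window k T
    agree : ∀ {i} → i < n → D i ≡ byLength (bitAt T) i
    agree {i} i<n = begin
      limit (codeLength i)                  ≡⟨ limit-stages {suc k} (<-trans ℓ<padded (length-padded<length-stages k)) ⟩
      bitAt (stages (suc k)) (codeLength i) ≡⟨ bitAt-++ˡ (padded k T) ℓ<padded ⟩
      bitAt (padded k T) (codeLength i)     ≡⟨ bitAt-++-replicate-false T n (codeLength i) ⟩
      bitAt T (codeLength i)                ∎
      where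
      open ≡-Reasoning
      ℓ<padded : codeLength i < length (padded k T)
      ℓ<padded = ≤-trans (s≤s (codeLength-≤ i)) (≤-trans i<n (window≤length-padded k T))

  D-undecided : ∀ k → ¬ DecidedBy k D
  D-undecided k decidedBy = not-¬ refl (begin
      D (code w)                              ≡⟨ cong limit (trans (codeLength-code w) (length-replicate ℓ)) ⟩
      limit ℓ                                 ≡⟨ limit-stages {suc k} (length-padded<length-stages k) ⟩
      bitAt (stages (suc k)) ℓ                ≡⟨ bitAt-++-length (padded k T) ⟩
      not (outputWithin (machineAt k) (clockAt k) w)
                                              ≡⟨ cong (not ∘ output) (Equivalence.to (decidesInTime⇔ (machineAt k) (clockAt k) D) decidedBy w) ⟩
      not (D (code w))                        ∎)
    where
    open ≡-Reasoning
    T = stages k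
    ℓ = length (padded k T)
    w = witness k T

  D-∉P : ¬ InP D
  D-∉P inP = let k , decidedBy = Equivalence.to (InP⇔DecidedBy D) inP in D-undecided k decidedBy

theorem2p15 : IsΣ⁰₂ InP × ¬ IsΠ⁰₂ InP
theorem2p15 = InP-Σ⁰₂ , λ (U , P⇔⋂U) →
  let open Diagonal U P⇔⋂U in D-∉P (Equivalence.from (P⇔⋂U D) D-∈U)
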